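{- Let $S$ be a finite non-empty set, let $b$ be an integer-valued submodular set-function on $S$ (values $+\infty$ allowed, $-\infty$ not) with $b(\emptyset)=0$ and $b(S)$ finite, and let $p$ be its complementary function, $p(X)=b(S)-b(S-X)$. Let $B=\{x\in\mathbb{R}^S:\widetilde x(S)=b(S),\ \widetilde x(Z)\le b(Z)\ \forall Z\subseteq S\}$ (equivalently $B=\{x:\widetilde x(S)=p(S),\ \widetilde x(Z)\ge p(Z)\ \forall Z\subseteq S\}$). For an integral element $m\in B\cap\mathbb{Z}^S$ the following four conditions are pairwise equivalent: (A) there are no elements $s,t\in S$ with $m(t)\ge m(s)+2$ such that $m+\chi_s-\chi_t\in B$; (B) there is a chain $\emptyset\subset C_1\subset C_2\subset\cdots\subset C_\ell=S$ of $m$-top sets, each of which is $m$-tight with respect to $p$ (i.e. $\widetilde m(C_i)=p(C_i)$), such that for every $i$ the restriction of $m$ to $S_i:=C_i-C_{i-1}$ (with $C_0=\emptyset$) is near-uniform; (C1) $m$ is decreasingly minimal in $B\cap\mathbb{Z}^S$; (C2) $m$ is increasingly maximal in $B\cap\mathbb{Z}^S$.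
   Context: For $x\in\mathbb{R}^S$ and $X\subseteq S$, $\widetilde x(X)=\sum_{s\in X}x(s)$; $\chi_Z$ is the characteristic vector of $Z$. A set $X\subseteq S$ is an $m$-top set if $m(u)\ge m(v)$ whenever $u\in X$, $v\in S-X$. An integral vector is near-uniform if its largest and smallest components differ by at most 1. For a vector $x$, $x{\downarrow}$ ($x{\uparrow}$) is the vector obtained by rearranging its components in decreasing (increasing) order. An element $m$ of a set $Q$ of vectors is decreasingly minimal (dec-min) if $m{\downarrow}$ is lexicographically smaller than or equal to $y{\downarrow}$ for every $y\in Q$, and increasingly maximal (inc-max) if $m{\uparrow}$ is lexicographically larger than or equal to $y{\uparrow}$ for every $y\in Q$. -}

module Defs where

open import Data.Nat using (ℕ; zero; suc)
open import Data.Integer using (ℤ; 0ℤ; 1ℤ; _+_; _-_; _≤_; _<_)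
import Data.Integer.Properties as ℤP
open import Data.Bool using (Bool; true; false; if_then_else_)
open import Data.Fin using (Fin; zero; suc; fromℕ; inject₁; _≟_)
open import Data.Fin.Subset using (Subset; _∈_; _∉_; _─_; _⊂_; ⊤; ⊥; _∩_; _∪_; ∁)
open import Data.Vec using ([]; _∷_)
open import Data.List using (List; reverse)
open import Data.Vec.Functional using (Vector; toList)
open import Data.Product using (Σ; _×_; _,_)
open import Data.Empty using () renaming (⊥ to Empty)
open import Relation.Nullary using (does)
open import Relation.Binary.PropositionalEquality using (_≡_)
open import Data.List.Relation.Binary.Lex.Strict using (Lex-≤)
import Data.List.Sort

data ℤ+∞ : Set where
  fin : ℤ → ℤ+∞
  +∞  : ℤ+∞

data ℤ-∞ : Set where
  fin : ℤ → ℤ-∞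
  -∞  : ℤ-∞

_+∞+_ : ℤ+∞ → ℤ+∞ → ℤ+∞
fin a +∞+ fin b = fin (a + b)
fin _ +∞+ +∞    = +∞
+∞    +∞+ _     = +∞

data _≤∞_ : ℤ+∞ → ℤ+∞ → Set where
  fin≤fin : ∀ {a b} → a ≤ b → fin a ≤∞ fin b
  ≤+∞     : ∀ {x} → x ≤∞ +∞

Submodular : ∀ {n} → (Subset n → ℤ+∞) → Set
Submodular b = ∀ X Y → (b (X ∩ Y) +∞+ b (X ∪ Y)) ≤∞ (b X +∞+ b Y)

-- Complementary function p(X) = b(S) − b(S − X) (b(S) finite, given as bS).
compl : ∀ {n} → (Subset n → ℤ+∞) → ℤ → Subset n → ℤ-∞
compl b bS X with b (∁ X)
... | fin v = fin (bS - v)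
... | +∞    = -∞

sumOver : ∀ {n} → Vector ℤ n → Subset n → ℤ
sumOver {zero}  x []      = 0ℤ
sumOver {suc n} x (c ∷ X) = (if c then x zero else 0ℤ) + sumOver (λ i → x (suc i)) X

InB : ∀ {n} → (Subset n → ℤ+∞) → ℤ → Vector ℤ n → Set
InB b bS x = (sumOver x ⊤ ≡ bS) × (∀ Z → fin (sumOver x Z) ≤∞ b Z)

χ : ∀ {n} → Fin n → Vector ℤ n
χ s i = if does (s ≟ i) then 1ℤ else 0ℤ

shift : ∀ {n} → Vector ℤ n → Fin n → Fin n → Vector ℤ n
shift m s t i = (m i + χ s i) - χ t i

IsTop : ∀ {n} → Vector ℤ n → Subset n → Set
IsTop m X = ∀ u v → u ∈ X → v ∉ X → m v ≤ m u

IsTight : ∀ {n} → (Subset n → ℤ-∞) → Vector ℤ n → Subset n → Set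
IsTight p m X = p X ≡ fin (sumOver m X)

NearUniformOn : ∀ {n} → Vector ℤ n → Subset n → Set
NearUniformOn m X = ∀ u v → u ∈ X → v ∈ X → m u ≤ m v + 1ℤ

open Data.List.Sort ℤP.≤-decTotalOrder using (sort)

inc : ∀ {n} → Vector ℤ n → List ℤ
inc x = sort (toList x)

dec : ∀ {n} → Vector ℤ n → List ℤ
dec x = reverse (sort (toList x))

_≤lex_ : List ℤ → List ℤ → Set
_≤lex_ = Lex-≤ _≡_ _<_

CondA : ∀ {n} → (Subset n → ℤ+∞) → ℤ → Vector ℤ n → Set
CondA b bS m = ∀ s t → m s + 1ℤ < m t → InB b bS (shift m s t) → Empty

CondB : ∀ {n} → (Subset n → ℤ+∞) → ℤ → Vector ℤ n → Set
CondB {n} b bS m =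
  Σ ℕ λ ℓ → Σ (Fin (suc ℓ) → Subset n) λ C →
    (C zero ≡ ⊥) × (C (fromℕ ℓ) ≡ ⊤) ×
    (∀ (i : Fin ℓ) → C (inject₁ i) ⊂ C (suc i)) ×
    (∀ (i : Fin ℓ) → IsTop m (C (suc i))) ×
    (∀ (i : Fin ℓ) → IsTight (compl b bS) m (C (suc i))) ×
    (∀ (i : Fin ℓ) → NearUniformOn m (C (suc i) ─ C (inject₁ i)))

DecMin : ∀ {n} → (Subset n → ℤ+∞) → ℤ → Vector ℤ n → Set
DecMin b bS m = ∀ y → InB b bS y → dec m ≤lex dec y

IncMax : ∀ {n} → (Subset n → ℤ+∞) → ℤ → Vector ℤ n → Set
IncMax b bS m = ∀ y → InB b bS y → inc y ≤lex inc m

-- Sorted vectors are compared through their threshold counts: dec m ≤lex dec y fails exactly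
-- when, at the largest level α where the numbers #≥ α of entries ≥ α differ, y has fewer of
-- them than m (dually for inc, with #≤ and the smallest differing level).
-- (B) ⇒ (C1): let C be the first set of the chain containing every entry ≥ α. Its entries are
-- ≥ α − 1, so m̃(C) = (α − 1)|C| + Σ_{j ≥ α} #≥ j (m), while the same expression with the
-- strictly smaller counts of y bounds ỹ(C) from above; this contradicts m̃(C) = p(C) ≤ ỹ(C).
-- (C2) is the mirror argument for −m on the complement of the last chain set avoiding all
-- entries ≤ β.  (C1), (C2) ⇒ (A): the move m + χ_s − χ_t lowers #≥ m(t) (resp. #≤ m(s)) and
-- no count beyond it.  (A) ⇒ (B): by (A), whenever m(u) + 1 < m(t) some b-tight set contains
-- u but not t; b-tight sets are closed under ∩ and ∪, so the complement C_l of
-- ⋂_{m(t) ≥ l} ⋃_u (these sets) is p-tight, contains {m ≥ l} and lies inside {m ≥ l − 1}.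
-- The distinct sets among the C_l form the chain.

module Submission where

open import Data.Bool using (Bool; true; false; if_then_else_; _∧_; _∨_)
import Data.Integer as ℤ
open import Data.Integer using (+≤+; +<+; -1ℤ; -≤+; ∣_∣; _⊔_; ℤ; 0ℤ; 1ℤ; _+_; _-_; -_; _≤_; _<_; _≥_; _≤?_; _<?_)
import Data.Integer.Properties as ℤₚ
open import Data.Integer.Tactic.RingSolver using (solve-∀)
open import Data.List using (List; []; _∷_; reverse; length)
import Data.List.Properties as Listₚ
open import Data.List.Relation.Unary.All as All using (All; []; _∷_)
open import Data.List.Relation.Unary.AllPairs using (AllPairs; []; _∷_)
import Data.List.Relation.Unary.AllPairs.Properties as AllPairsₚ
open import Data.List.Relation.Unary.Linked.Properties using (Linked⇒AllPairs)
open import Data.List.Relation.Binary.Lex.Core using (base; halt; this; next)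
open import Data.List.Relation.Binary.Permutation.Propositional using (_↭_; refl; prep; swap; trans; ↭-sym)
open import Data.List.Relation.Binary.Permutation.Propositional.Properties using (All-resp-↭; ↭-reverse; ↭-length)
open import Data.List.Sort ℤₚ.≤-decTotalOrder using (sort-↭; sort-↗)
open import Data.Nat using (ℕ; zero; suc; z≤n; s≤s)
import Data.Nat.Properties as ℕₚ
open import Data.Product using (Σ; ∃; _×_; _,_; proj₁; proj₂)
open import Data.Sum using (_⊎_; inj₁; inj₂)
open import Data.Unit using (tt)
open import Data.Fin using (Fin; zero; suc; fromℕ; inject₁; _≟_)
import Data.Fin.Properties as Finₚ
open import Data.Fin.Subset.Properties
  using (_∈?_; ∉⊥; ∈⊤; drop-there; ⊆-antisym; ⊆⊤; ⊥⊆; anySubset?; p─q⊆p; x∈p∧x∉q⇒x∈p─q;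
         x∈p∪q⁺; x∈p∪q⁻; x∈p∩q⁺; x∈p∩q⁻; x∉∁p⇒x∈p; x∉p⇒x∈∁p; x∈∁p⇒x∉p)
open import Data.Fin.Subset using (Subset; _─_; _⊂_; _⊆_; _∈_; _∉_; ⊤; ⊥; _∩_; _∪_; ∁)
open import Data.Vec using ([]; _∷_; here; there; lookup)
import Data.Vec.Properties as Vecₚ
open import Data.Vec.Functional using (Vector; toList)
open import Function using (flip; _∘_)
open import Function.Bundles using (_⇔_; mk⇔)
open import Relation.Binary.Definitions using (tri<; tri≈; tri>)
open import Relation.Nullary using (¬_; Dec; does; yes; no; contradiction)
open import Relation.Nullary.Decidable using (dec-true; dec-false; _→-dec_; _×-dec_; ¬?; decidable-stable)
open import Relation.Binary.PropositionalEquality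
  using (_≡_; _≢_; _≗_; refl; sym; cong; cong₂; subst; subst₂)
  renaming (trans to ≡-trans)

open import Defs

+-cancelˡ-≡ : ∀ i {j k} → i + j ≡ i + k → j ≡ k
+-cancelˡ-≡ i {j} {k} e = ≡-trans (sym (cancel i j)) (≡-trans (cong (_- i) e) (cancel i k))
  where
  cancel : ∀ a b → (a + b) - a ≡ b
  cancel = solve-∀

+-cancelˡ-< : ∀ i {j k} → i + j < i + k → j < k
+-cancelˡ-< i {j} {k} lt = subst₂ _<_ (cancel i j) (cancel i k) (ℤₚ.+-monoˡ-< (- i) lt)
  where
  cancel : ∀ a b → (a + b) - a ≡ b
  cancel = solve-∀

<⇒+1≤ : ∀ {i j} → i < j → i + 1ℤ ≤ j
<⇒+1≤ {i} i<j = subst (_≤ _) (ℤₚ.+-comm 1ℤ i) (ℤₚ.i<j⇒suc[i]≤j i<j)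

+1≤⇒< : ∀ {i j} → i + 1ℤ ≤ j → i < j
+1≤⇒< {i} i+1≤j = ℤₚ.suc[i]≤j⇒i<j (subst (_≤ _) (ℤₚ.+-comm i 1ℤ) i+1≤j)

i<i+1 : ∀ i → i < i + 1ℤ
i<i+1 i = +1≤⇒< ℤₚ.≤-refl

+1-cancel : ∀ i → (i + 1ℤ) - 1ℤ ≡ i
+1-cancel = solve-∀

<⇒≤-1 : ∀ {i j} → i < j → i ≤ j - 1ℤ
<⇒≤-1 {i} i<j = subst (_≤ _) (+1-cancel i) (ℤₚ.+-monoˡ-≤ (- 1ℤ) (<⇒+1≤ i<j))

i-1<i : ∀ i → i - 1ℤ < i
i-1<i i = subst (_< i) (ℤₚ.+-comm -1ℤ i) (ℤₚ.i≤pred[j]⇒i<j ℤₚ.≤-refl)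

i≤+∣i∣ : ∀ i → i ≤ ℤ.+ ∣ i ∣
i≤+∣i∣ (ℤ.+ _)    = ℤₚ.≤-refl
i≤+∣i∣ ℤ.-[1+ _ ] = -≤+

≤⊎> : ∀ i j → i ≤ j ⊎ j < i
≤⊎> i j with i ≤? j
... | yes i≤j = inj₁ i≤j
... | no  i≰j = inj₂ (ℤₚ.≰⇒> i≰j)

-- Threshold counts and the lexicographic order of sorted lists

indicator : Bool → ℤ
indicator true  = 1ℤ
indicator false = 0ℤ

indicator-nonneg : ∀ c → 0ℤ ≤ indicator c
indicator-nonneg true  = +≤+ z≤n
indicator-nonneg false = ℤₚ.≤-refl

false⇒indicator≤ : ∀ {c} → c ≡ false → ∀ d → indicator c ≤ indicator d
false⇒indicator≤ refl d = indicator-nonneg d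

indicator-< : ∀ {c d} → c ≡ false → d ≡ true → indicator c < indicator d
indicator-< refl refl = +<+ (s≤s z≤n)

count : (ℤ → Bool) → List ℤ → ℤ
count p []       = 0ℤ
count p (x ∷ xs) = indicator (p x) + count p xs

count-nonneg : ∀ p xs → 0ℤ ≤ count p xs
count-nonneg p []       = ℤₚ.≤-refl
count-nonneg p (x ∷ xs) = ℤₚ.+-mono-≤ (indicator-nonneg (p x)) (count-nonneg p xs)

count-none : ∀ p {xs} → All (λ v → p v ≡ false) xs → count p xs ≡ 0ℤ
count-none p []         = refl
count-none p (px ∷ pxs) rewrite px = ≡-trans (ℤₚ.+-identityˡ _) (count-none p pxs)

count-head : ∀ p x xs → p x ≡ true → 0ℤ < count p (x ∷ xs)
count-head p x xs px rewrite px = ℤₚ.<-≤-trans (+<+ (s≤s z≤n)) (ℤₚ.+-monoʳ-≤ 1ℤ (count-nonneg p xs))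

count-↭ : ∀ p {xs ys} → xs ↭ ys → count p xs ≡ count p ys
count-↭ p refl         = refl
count-↭ p (prep x xs↭ys) = cong (indicator (p x) +_) (count-↭ p xs↭ys)
count-↭ p (swap {xs = xs} x y xs↭ys) =
  ≡-trans (exchange (indicator (p x)) (indicator (p y)) (count p xs))
          (cong (λ c → indicator (p y) + (indicator (p x) + c)) (count-↭ p xs↭ys))
  where
  exchange : ∀ a b c → a + (b + c) ≡ b + (a + c)
  exchange = solve-∀
count-↭ p (trans xs↭ys ys↭zs) = ≡-trans (count-↭ p xs↭ys) (count-↭ p ys↭zs)

atLeast : ℤ → ℤ → Bool
atLeast j v = does (j ≤? v)

atMost : ℤ → ℤ → Bool
atMost j v = does (v ≤? j)

atLeast-below : ∀ {j v} → v < j → atLeast j v ≡ false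
atLeast-below {j} {v} v<j = dec-false (j ≤? v) (ℤₚ.<⇒≱ v<j)

atMost-above : ∀ {j v} → j < v → atMost j v ≡ false
atMost-above {j} {v} j<v = dec-false (v ≤? j) (ℤₚ.<⇒≱ j<v)

#≥ : List ℤ → ℤ → ℤ
#≥ xs j = count (atLeast j) xs

#≤ : List ℤ → ℤ → ℤ
#≤ xs j = count (atMost j) xs

LastDifferenceLt : (ℤ → ℤ) → (ℤ → ℤ) → Set
LastDifferenceLt f g = Σ ℤ λ α → f α < g α × (∀ j → α < j → f j ≡ g j)

FirstDifferenceLt : (ℤ → ℤ) → (ℤ → ℤ) → Set
FirstDifferenceLt f g = Σ ℤ λ β → f β < g β × (∀ j → j < β → f j ≡ g j)

LastDifferenceLt-cong : ∀ {f f′ g g′} → f ≗ f′ → g ≗ g′ → LastDifferenceLt f g → LastDifferenceLt f′ g′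
LastDifferenceLt-cong f≗f′ g≗g′ (α , lt , eq) =
  α , subst₂ _<_ (f≗f′ α) (g≗g′ α) lt , λ j α<j → ≡-trans (sym (f≗f′ j)) (≡-trans (eq j α<j) (g≗g′ j))

FirstDifferenceLt-cong : ∀ {f f′ g g′} → f ≗ f′ → g ≗ g′ → FirstDifferenceLt f g → FirstDifferenceLt f′ g′
FirstDifferenceLt-cong f≗f′ g≗g′ (β , lt , eq) =
  β , subst₂ _<_ (f≗f′ β) (g≗g′ β) lt , λ j j<β → ≡-trans (sym (f≗f′ j)) (≡-trans (eq j j<β) (g≗g′ j))

LastDifferenceLt-+ˡ : ∀ (h : ℤ → ℤ) {f g} → LastDifferenceLt f g →
                      LastDifferenceLt (λ j → h j + f j) (λ j → h j + g j)
LastDifferenceLt-+ˡ h (α , lt , eq) = α , ℤₚ.+-monoʳ-< (h α) lt , λ j α<j → cong (h j +_) (eq j α<j)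

LastDifferenceLt-+ˡ⁻ : ∀ (h : ℤ → ℤ) {f g} → LastDifferenceLt (λ j → h j + f j) (λ j → h j + g j) →
                       LastDifferenceLt f g
LastDifferenceLt-+ˡ⁻ h (α , lt , eq) = α , +-cancelˡ-< (h α) lt , λ j α<j → +-cancelˡ-≡ (h j) (eq j α<j)

FirstDifferenceLt-+ˡ : ∀ (h : ℤ → ℤ) {f g} → FirstDifferenceLt f g →
                       FirstDifferenceLt (λ j → h j + f j) (λ j → h j + g j)
FirstDifferenceLt-+ˡ h (β , lt , eq) = β , ℤₚ.+-monoʳ-< (h β) lt , λ j j<β → cong (h j +_) (eq j j<β)

FirstDifferenceLt-+ˡ⁻ : ∀ (h : ℤ → ℤ) {f g} → FirstDifferenceLt (λ j → h j + f j) (λ j → h j + g j) →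
                        FirstDifferenceLt f g
FirstDifferenceLt-+ˡ⁻ h (β , lt , eq) = β , +-cancelˡ-< (h β) lt , λ j j<β → +-cancelˡ-≡ (h j) (eq j j<β)

Descending : List ℤ → Set
Descending = AllPairs _≥_

Ascending : List ℤ → Set
Ascending = AllPairs _≤_

#≥-above : ∀ {j} xs → All (_< j) xs → #≥ xs j ≡ 0ℤ
#≥-above {j} xs xs<j = count-none (atLeast j) (All.map atLeast-below xs<j)

#≤-below : ∀ {j} xs → All (j <_) xs → #≤ xs j ≡ 0ℤ
#≤-below {j} xs j<xs = count-none (atMost j) (All.map atMost-above j<xs)

#≥-head : ∀ x xs → 0ℤ < #≥ (x ∷ xs) x
#≥-head x xs = count-head (atLeast x) x xs (dec-true (x ≤? x) ℤₚ.≤-refl)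

#≤-head : ∀ x xs → 0ℤ < #≤ (x ∷ xs) x
#≤-head x xs = count-head (atMost x) x xs (dec-true (x ≤? x) ℤₚ.≤-refl)

head<⇒all< : ∀ {x xs j} → Descending (x ∷ xs) → x < j → All (_< j) (x ∷ xs)
head<⇒all< (x≥xs ∷ _) x<j = x<j ∷ All.map (λ v≤x → ℤₚ.≤-<-trans v≤x x<j) x≥xs

<head⇒<all : ∀ {x xs j} → Ascending (x ∷ xs) → j < x → All (j <_) (x ∷ xs)
<head⇒<all (x≤xs ∷ _) j<x = j<x ∷ All.map (λ x≤v → ℤₚ.<-≤-trans j<x x≤v) x≤xs

lastDifference-at-head : ∀ {x a b} → Descending (x ∷ a) → All (_< x) b → LastDifferenceLt (#≥ b) (#≥ (x ∷ a))
lastDifference-at-head {x} {a} {b} dxa b<x =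
  x , subst (_< _) (sym (#≥-above b b<x)) (#≥-head x a)
    , λ j x<j → ≡-trans (#≥-above b (All.map (λ v<x → ℤₚ.<-trans v<x x<j) b<x))
                        (sym (#≥-above (x ∷ a) (head<⇒all< dxa x<j)))

firstDifference-at-head : ∀ {y a b} → All (y <_) a → Ascending (y ∷ b) → FirstDifferenceLt (#≤ a) (#≤ (y ∷ b))
firstDifference-at-head {y} {a} {b} y<a ayb =
  y , subst (_< _) (sym (#≤-below a y<a)) (#≤-head y b)
    , λ j j<y → ≡-trans (#≤-below a (All.map (λ y<v → ℤₚ.<-trans j<y y<v) y<a))
                        (sym (#≤-below (y ∷ b) (<head⇒<all ayb j<y)))

≤lex⊎lastDifference : ∀ {a b} → Descending a → Descending b → a ≤lex b ⊎ LastDifferenceLt (#≥ b) (#≥ a)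
≤lex⊎lastDifference {[]}    {[]}    _ _ = inj₁ (base tt)
≤lex⊎lastDifference {[]}    {_ ∷ _} _ _ = inj₁ halt
≤lex⊎lastDifference {_ ∷ _} {[]}    da _ = inj₂ (lastDifference-at-head da [])
≤lex⊎lastDifference {x ∷ a} {y ∷ b} da@(_ ∷ da′) db@(_ ∷ db′) with ℤₚ.<-cmp x y
... | tri< x<y _ _ = inj₁ (this x<y)
... | tri> _ _ y<x = inj₂ (lastDifference-at-head da (head<⇒all< db y<x))
... | tri≈ _ refl _ with ≤lex⊎lastDifference da′ db′
...   | inj₁ a≤b = inj₁ (next refl a≤b)
...   | inj₂ d   = inj₂ (LastDifferenceLt-+ˡ (λ j → indicator (atLeast j x)) d)

lastDifference⇒≰lex : ∀ {a b} → Descending a → Descending b → LastDifferenceLt (#≥ b) (#≥ a) → ¬ a ≤lex b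
lastDifference⇒≰lex _ _ (_ , lt , _) (base _) = ℤₚ.<-irrefl refl lt
lastDifference⇒≰lex {b = b} _ _ (α , lt , _) halt = ℤₚ.<⇒≱ lt (count-nonneg (atLeast α) b)
lastDifference⇒≰lex {x ∷ a} {y ∷ b} da _ (α , lt , eq) (this x<y) with ≤⊎> α x
... | inj₁ α≤x = ℤₚ.<-irrefl refl
      (subst (0ℤ <_) (≡-trans (eq y (ℤₚ.≤-<-trans α≤x x<y)) (#≥-above (x ∷ a) (head<⇒all< da x<y))) (#≥-head y b))
... | inj₂ x<α = ℤₚ.<⇒≱ (subst (_ <_) (#≥-above (x ∷ a) (head<⇒all< da x<α)) lt) (count-nonneg (atLeast α) (y ∷ b))
lastDifference⇒≰lex {x ∷ _} (_ ∷ da) (_ ∷ db) d (next refl a≤b) =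
  lastDifference⇒≰lex da db (LastDifferenceLt-+ˡ⁻ (λ j → indicator (atLeast j x)) d) a≤b

≤lex⊎firstDifference : ∀ {a b} → Ascending a → Ascending b → length a ≡ length b →
                       a ≤lex b ⊎ FirstDifferenceLt (#≤ a) (#≤ b)
≤lex⊎firstDifference {[]}    {[]}    _ _ _  = inj₁ (base tt)
≤lex⊎firstDifference {[]}    {_ ∷ _} _ _ _  = inj₁ halt
≤lex⊎firstDifference {x ∷ a} {y ∷ b} aa@(_ ∷ aa′) ab@(_ ∷ ab′) |a|≡|b| with ℤₚ.<-cmp x y
... | tri< x<y _ _ = inj₁ (this x<y)
... | tri> _ _ y<x = inj₂ (firstDifference-at-head (<head⇒<all aa y<x) ab)
... | tri≈ _ refl _ with ≤lex⊎firstDifference aa′ ab′ (ℕₚ.suc-injective |a|≡|b|)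
...   | inj₁ a≤b = inj₁ (next refl a≤b)
...   | inj₂ d   = inj₂ (FirstDifferenceLt-+ˡ (λ j → indicator (atMost j x)) d)

firstDifference⇒≰lex : ∀ {a b} → Ascending a → Ascending b → length a ≡ length b →
                       FirstDifferenceLt (#≤ a) (#≤ b) → ¬ a ≤lex b
firstDifference⇒≰lex _ _ _ (_ , lt , _) (base _) = ℤₚ.<-irrefl refl lt
firstDifference⇒≰lex _ _ () _ halt
firstDifference⇒≰lex {x ∷ a} {y ∷ b} _ ab _ (β , lt , eq) (this x<y) with ≤⊎> y β
... | inj₁ y≤β = ℤₚ.<-irrefl refl
      (subst (0ℤ <_) (≡-trans (eq x (ℤₚ.<-≤-trans x<y y≤β)) (#≤-below (y ∷ b) (<head⇒<all ab x<y))) (#≤-head x a))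
... | inj₂ β<y = ℤₚ.<⇒≱ (subst (_ <_) (#≤-below (y ∷ b) (<head⇒<all ab β<y)) lt) (count-nonneg (atMost β) (x ∷ a))
firstDifference⇒≰lex {x ∷ _} (_ ∷ aa) (_ ∷ ab) |a|≡|b| d (next refl a≤b) =
  firstDifference⇒≰lex aa ab (ℕₚ.suc-injective |a|≡|b|) (FirstDifferenceLt-+ˡ⁻ (λ j → indicator (atMost j x)) d) a≤b

AllPairs-reverse : ∀ {A : Set} {R : A → A → Set} {xs} → AllPairs R xs → AllPairs (flip R) (reverse xs)
AllPairs-reverse [] = []
AllPairs-reverse {xs = x ∷ xs} (Rx ∷ Rxs) rewrite Listₚ.unfold-reverse x xs =
  AllPairsₚ.++⁺ (AllPairs-reverse Rxs) ([] ∷ [])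
                (All.map (_∷ []) (All-resp-↭ (↭-sym (↭-reverse xs)) Rx))

inc-ascending : ∀ {n} (x : Vector ℤ n) → Ascending (inc x)
inc-ascending x = Linked⇒AllPairs ℤₚ.≤-trans (sort-↗ (toList x))

dec-descending : ∀ {n} (x : Vector ℤ n) → Descending (dec x)
dec-descending x = AllPairs-reverse (inc-ascending x)

count-inc : ∀ {n} p (x : Vector ℤ n) → count p (inc x) ≡ count p (toList x)
count-inc p x = count-↭ p (sort-↭ (toList x))

count-dec : ∀ {n} p (x : Vector ℤ n) → count p (dec x) ≡ count p (toList x)
count-dec p x = ≡-trans (count-↭ p (↭-reverse (inc x))) (count-inc p x)

length-inc : ∀ {n} (x : Vector ℤ n) → length (inc x) ≡ n
length-inc x = ≡-trans (↭-length (sort-↭ (toList x))) (Listₚ.length-tabulate x)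

dec-≤lex⊎lastDifference : ∀ {n} (m y : Vector ℤ n) →
                          dec m ≤lex dec y ⊎ LastDifferenceLt (#≥ (toList y)) (#≥ (toList m))
dec-≤lex⊎lastDifference m y with ≤lex⊎lastDifference (dec-descending m) (dec-descending y)
... | inj₁ m≤y = inj₁ m≤y
... | inj₂ d   = inj₂ (LastDifferenceLt-cong (λ j → count-dec (atLeast j) y) (λ j → count-dec (atLeast j) m) d)

lastDifference⇒dec-≰lex : ∀ {n} (m y : Vector ℤ n) →
                          LastDifferenceLt (#≥ (toList y)) (#≥ (toList m)) → ¬ dec m ≤lex dec y
lastDifference⇒dec-≰lex m y d = lastDifference⇒≰lex (dec-descending m) (dec-descending y)
  (LastDifferenceLt-cong (λ j → sym (count-dec (atLeast j) y)) (λ j → sym (count-dec (atLeast j) m)) d)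

inc-≤lex⊎firstDifference : ∀ {n} (m y : Vector ℤ n) →
                           inc y ≤lex inc m ⊎ FirstDifferenceLt (#≤ (toList y)) (#≤ (toList m))
inc-≤lex⊎firstDifference m y
  with ≤lex⊎firstDifference (inc-ascending y) (inc-ascending m) (≡-trans (length-inc y) (sym (length-inc m)))
... | inj₁ y≤m = inj₁ y≤m
... | inj₂ d   = inj₂ (FirstDifferenceLt-cong (λ j → count-inc (atMost j) y) (λ j → count-inc (atMost j) m) d)

firstDifference⇒inc-≰lex : ∀ {n} (m y : Vector ℤ n) →
                           FirstDifferenceLt (#≤ (toList y)) (#≤ (toList m)) → ¬ inc y ≤lex inc m
firstDifference⇒inc-≰lex m y d =
  firstDifference⇒≰lex (inc-ascending y) (inc-ascending m) (≡-trans (length-inc y) (sym (length-inc m)))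
    (FirstDifferenceLt-cong (λ j → sym (count-inc (atMost j) y)) (λ j → sym (count-inc (atMost j) m)) d)

sumOver-cong : ∀ {n} (f g : Vector ℤ n) X → (∀ i → i ∈ X → f i ≡ g i) → sumOver f X ≡ sumOver g X
sumOver-cong f g []          _   = refl
sumOver-cong f g (true ∷ X)  f≗g =
  cong₂ _+_ (f≗g zero here) (sumOver-cong (f ∘ suc) (g ∘ suc) X (λ i i∈X → f≗g (suc i) (there i∈X)))
sumOver-cong f g (false ∷ X) f≗g =
  cong (0ℤ +_) (sumOver-cong (f ∘ suc) (g ∘ suc) X (λ i i∈X → f≗g (suc i) (there i∈X)))

sumOver-mono : ∀ {n} (f g : Vector ℤ n) X → (∀ i → i ∈ X → f i ≤ g i) → sumOver f X ≤ sumOver g X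
sumOver-mono f g []          _   = ℤₚ.≤-refl
sumOver-mono f g (true ∷ X)  f≤g =
  ℤₚ.+-mono-≤ (f≤g zero here) (sumOver-mono (f ∘ suc) (g ∘ suc) X (λ i i∈X → f≤g (suc i) (there i∈X)))
sumOver-mono f g (false ∷ X) f≤g =
  ℤₚ.+-monoʳ-≤ 0ℤ (sumOver-mono (f ∘ suc) (g ∘ suc) X (λ i i∈X → f≤g (suc i) (there i∈X)))

sumOver-zero : ∀ {n} (X : Subset n) → sumOver (λ _ → 0ℤ) X ≡ 0ℤ
sumOver-zero []          = refl
sumOver-zero (true ∷ X)  = ≡-trans (ℤₚ.+-identityˡ _) (sumOver-zero X)
sumOver-zero (false ∷ X) = ≡-trans (ℤₚ.+-identityˡ _) (sumOver-zero X)

sumOver-⊥ : ∀ {n} (f : Vector ℤ n) → sumOver f ⊥ ≡ 0ℤ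
sumOver-⊥ {zero}  f = refl
sumOver-⊥ {suc n} f = ≡-trans (ℤₚ.+-identityˡ _) (sumOver-⊥ (f ∘ suc))

sumOver-+ : ∀ {n} (f g : Vector ℤ n) X → sumOver (λ i → f i + g i) X ≡ sumOver f X + sumOver g X
sumOver-+ f g [] = refl
sumOver-+ f g (c ∷ X) rewrite sumOver-+ (f ∘ suc) (g ∘ suc) X = head c
  where
  interchange : ∀ a b c d → (a + b) + (c + d) ≡ (a + c) + (b + d)
  interchange = solve-∀
  head : ∀ c → (if c then f zero + g zero else 0ℤ) + (sumOver (f ∘ suc) X + sumOver (g ∘ suc) X)
             ≡ ((if c then f zero else 0ℤ) + sumOver (f ∘ suc) X) + ((if c then g zero else 0ℤ) + sumOver (g ∘ suc) X)
  head true  = interchange (f zero) (g zero) (sumOver (f ∘ suc) X) (sumOver (g ∘ suc) X)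
  head false = interchange 0ℤ 0ℤ (sumOver (f ∘ suc) X) (sumOver (g ∘ suc) X)

sumOver-neg : ∀ {n} (f : Vector ℤ n) X → sumOver (λ i → - f i) X ≡ - sumOver f X
sumOver-neg f [] = refl
sumOver-neg f (c ∷ X) rewrite sumOver-neg (f ∘ suc) X = head c
  where
  neg-distrib : ∀ a b → - a + - b ≡ - (a + b)
  neg-distrib = solve-∀
  head : ∀ c → (if c then - f zero else 0ℤ) + - sumOver (f ∘ suc) X ≡ - ((if c then f zero else 0ℤ) + sumOver (f ∘ suc) X)
  head true  = neg-distrib (f zero) (sumOver (f ∘ suc) X)
  head false = neg-distrib 0ℤ (sumOver (f ∘ suc) X)

sumOver-∁ : ∀ {n} (f : Vector ℤ n) X → sumOver f (∁ X) ≡ sumOver f ⊤ - sumOver f X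
sumOver-∁ f [] = refl
sumOver-∁ f (true ∷ X) rewrite sumOver-∁ (f ∘ suc) X = cancel (f zero) (sumOver (f ∘ suc) ⊤) (sumOver (f ∘ suc) X)
  where
  cancel : ∀ a b c → 0ℤ + (b - c) ≡ (a + b) - (a + c)
  cancel = solve-∀
sumOver-∁ f (false ∷ X) rewrite sumOver-∁ (f ∘ suc) X = regroup (f zero) (sumOver (f ∘ suc) ⊤) (sumOver (f ∘ suc) X)
  where
  regroup : ∀ a b c → a + (b - c) ≡ (a + b) - (0ℤ + c)
  regroup = solve-∀

sumOver-∩∪ : ∀ {n} (f : Vector ℤ n) X Y → sumOver f (X ∩ Y) + sumOver f (X ∪ Y) ≡ sumOver f X + sumOver f Y
sumOver-∩∪ f [] [] = refl
sumOver-∩∪ f (c ∷ X) (d ∷ Y) =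
  ≡-trans (interchange (pick (c ∧ d)) (sumOver (f ∘ suc) (X ∩ Y)) (pick (c ∨ d)) (sumOver (f ∘ suc) (X ∪ Y)))
          (≡-trans (cong₂ _+_ (head c d) (sumOver-∩∪ (f ∘ suc) X Y))
                   (sym (interchange (pick c) (sumOver (f ∘ suc) X) (pick d) (sumOver (f ∘ suc) Y))))
  where
  interchange : ∀ a b c d → (a + b) + (c + d) ≡ (a + c) + (b + d)
  interchange = solve-∀
  pick : Bool → ℤ
  pick c = if c then f zero else 0ℤ
  head : ∀ c d → pick (c ∧ d) + pick (c ∨ d) ≡ pick c + pick d
  head true  true  = refl
  head true  false = ℤₚ.+-comm 0ℤ (f zero)
  head false true  = refl
  head false false = refl

sumOver-χ : ∀ {n} (s : Fin n) X → sumOver (χ s) X ≡ indicator (lookup X s)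
sumOver-χ zero (c ∷ X) =
  ≡-trans (cong ((if c then 1ℤ else 0ℤ) +_) (≡-trans (sumOver-cong _ _ X (λ _ _ → refl)) (sumOver-zero X))) (head c)
  where
  head : ∀ c → (if c then 1ℤ else 0ℤ) + 0ℤ ≡ indicator c
  head true  = refl
  head false = refl
sumOver-χ (suc s) (c ∷ X) = ≡-trans (cong (_+ _) (head c)) (≡-trans (ℤₚ.+-identityˡ _) (sumOver-χ s X))
  where
  head : ∀ c → (if c then 0ℤ else 0ℤ) ≡ 0ℤ
  head true  = refl
  head false = refl

sumOver≤sumOver-⊤ : ∀ {n} (f : Vector ℤ n) X → (∀ i → 0ℤ ≤ f i) → sumOver f X ≤ sumOver f ⊤
sumOver≤sumOver-⊤ f []          _   = ℤₚ.≤-refl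
sumOver≤sumOver-⊤ f (true ∷ X)  f≥0 = ℤₚ.+-monoʳ-≤ (f zero) (sumOver≤sumOver-⊤ (f ∘ suc) X (f≥0 ∘ suc))
sumOver≤sumOver-⊤ f (false ∷ X) f≥0 = ℤₚ.+-mono-≤ (f≥0 zero) (sumOver≤sumOver-⊤ (f ∘ suc) X (f≥0 ∘ suc))

sumOver≡sumOver-⊤ : ∀ {n} (f : Vector ℤ n) X → (∀ i → i ∉ X → f i ≡ 0ℤ) → sumOver f X ≡ sumOver f ⊤
sumOver≡sumOver-⊤ f []          _   = refl
sumOver≡sumOver-⊤ f (true ∷ X)  f≡0 =
  cong (f zero +_) (sumOver≡sumOver-⊤ (f ∘ suc) X (λ i i∉X → f≡0 (suc i) (i∉X ∘ drop-there)))
sumOver≡sumOver-⊤ f (false ∷ X) f≡0 =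
  cong₂ _+_ (sym (f≡0 zero λ ())) (sumOver≡sumOver-⊤ (f ∘ suc) X (λ i i∉X → f≡0 (suc i) (i∉X ∘ drop-there)))

count-toList : ∀ {n} p (x : Vector ℤ n) → count p (toList x) ≡ sumOver (λ i → indicator (p (x i))) ⊤
count-toList {zero}  p x = refl
count-toList {suc n} p x = cong (indicator (p (x zero)) +_) (count-toList p (x ∘ suc))

sumOver⊤-< : ∀ {n} (f g : Vector ℤ n) t → (∀ i → f i ≤ g i) → f t < g t → sumOver f ⊤ < sumOver g ⊤
sumOver⊤-< f g zero    f≤g ft<gt = ℤₚ.+-mono-<-≤ ft<gt (sumOver-mono (f ∘ suc) (g ∘ suc) ⊤ (λ i _ → f≤g (suc i)))
sumOver⊤-< f g (suc t) f≤g ft<gt = ℤₚ.+-mono-≤-< (f≤g zero) (sumOver⊤-< (f ∘ suc) (g ∘ suc) t (f≤g ∘ suc) ft<gt)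

count-< : ∀ {n} p (x y : Vector ℤ n) t → (∀ i → indicator (p (x i)) ≤ indicator (p (y i))) →
          p (x t) ≡ false → p (y t) ≡ true → count p (toList x) < count p (toList y)
count-< p x y t x≤y pxt pyt =
  subst₂ _<_ (sym (count-toList p x)) (sym (count-toList p y)) (sumOver⊤-< _ _ t x≤y (indicator-< pxt pyt))

count-cong : ∀ {n} p q (x y : Vector ℤ n) → (∀ i → p (x i) ≡ q (y i)) → count p (toList x) ≡ count q (toList y)
count-cong p q x y px≡qy =
  ≡-trans (count-toList p x)
          (≡-trans (sumOver-cong _ _ ⊤ (λ i _ → cong indicator (px≡qy i))) (sym (count-toList q y)))

max : ∀ {n} → Vector ℤ n → ℤ
max {zero}  x = 0ℤ
max {suc n} x = x zero ⊔ max (x ∘ suc)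

≤max : ∀ {n} (x : Vector ℤ n) i → x i ≤ max x
≤max x zero    = ℤₚ.i≤i⊔j (x zero) _
≤max x (suc i) = ℤₚ.≤-trans (≤max (x ∘ suc) i) (ℤₚ.i≤j⊔i (x zero) _)

-- The counting inequality

-- excess a v = max 0 (v − a + 1) counts the levels j ≥ a with j ≤ v, so it telescopes into the #≥ j.
excess : ℤ → ℤ → ℤ
excess a v = if atLeast a v then (v - a) + 1ℤ else 0ℤ

excess-nonneg : ∀ a v → 0ℤ ≤ excess a v
excess-nonneg a v with a ≤? v
... | yes a≤v = ℤₚ.≤-trans (ℤₚ.i≤j⇒0≤j-i a≤v) (ℤₚ.i≤i+j (v - a) 1ℤ)
... | no  _   = ℤₚ.≤-refl

excess-below : ∀ {a v} → v < a → excess a v ≡ 0ℤ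
excess-below {a} {v} v<a rewrite dec-false (a ≤? v) (ℤₚ.<⇒≱ v<a) = refl

excess-step : ∀ a v → excess a v ≡ excess (a + 1ℤ) v + indicator (atLeast a v)
excess-step a v with ≤⊎> (a + 1ℤ) v | ≤⊎> a v
... | inj₁ a+1≤v | _
  rewrite dec-true (a ≤? v) (ℤₚ.≤-trans (ℤₚ.i≤i+j a 1ℤ) a+1≤v) | dec-true (a + 1ℤ ≤? v) a+1≤v = regroup v a
  where
  regroup : ∀ v a → (v - a) + 1ℤ ≡ ((v - (a + 1ℤ)) + 1ℤ) + 1ℤ
  regroup = solve-∀
... | inj₂ v<a+1 | inj₁ a≤v
  rewrite ℤₚ.≤-antisym (subst (v ≤_) (+1-cancel a) (<⇒≤-1 v<a+1)) a≤v
        | dec-true (a ≤? a) ℤₚ.≤-refl | excess-below (i<i+1 a) = cancel a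
  where
  cancel : ∀ a → (a - a) + 1ℤ ≡ 0ℤ + 1ℤ
  cancel = solve-∀
... | inj₂ v<a+1 | inj₂ v<a
  rewrite excess-below v<a+1 | excess-below v<a | dec-false (a ≤? v) (ℤₚ.<⇒≱ v<a) = refl

≤excess : ∀ a v → v ≤ (a - 1ℤ) + excess a v
≤excess a v with ≤⊎> a v
... | inj₁ a≤v rewrite dec-true (a ≤? v) a≤v = ℤₚ.≤-reflexive (regroup a v)
  where
  regroup : ∀ a v → v ≡ (a - 1ℤ) + ((v - a) + 1ℤ)
  regroup = solve-∀
... | inj₂ v<a rewrite excess-below v<a = subst (v ≤_) (sym (ℤₚ.+-identityʳ (a - 1ℤ))) (<⇒≤-1 v<a)

≡excess : ∀ {a v} → a ≤ v + 1ℤ → v ≡ (a - 1ℤ) + excess a v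
≡excess {a} {v} a≤v+1 with ≤⊎> a v
... | inj₁ a≤v rewrite dec-true (a ≤? v) a≤v = regroup a v
  where
  regroup : ∀ a v → v ≡ (a - 1ℤ) + ((v - a) + 1ℤ)
  regroup = solve-∀
... | inj₂ v<a rewrite excess-below v<a =
  ≡-trans (sym (+1-cancel v))
          (≡-trans (cong (_- 1ℤ) (ℤₚ.≤-antisym (<⇒+1≤ v<a) a≤v+1)) (sym (ℤₚ.+-identityʳ (a - 1ℤ))))

totalExcess : ∀ {n} → ℤ → Vector ℤ n → ℤ
totalExcess a x = sumOver (λ i → excess a (x i)) ⊤

totalExcess-step : ∀ {n} a (x : Vector ℤ n) → totalExcess a x ≡ totalExcess (a + 1ℤ) x + #≥ (toList x) a
totalExcess-step a x =
  ≡-trans (sumOver-cong _ _ ⊤ (λ i _ → excess-step a (x i)))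
          (≡-trans (sumOver-+ (λ i → excess (a + 1ℤ) (x i)) (λ i → indicator (atLeast a (x i))) ⊤)
                   (cong (totalExcess (a + 1ℤ) x +_) (sym (count-toList (atLeast a) x))))

totalExcess-above : ∀ {n} {a} (x : Vector ℤ n) → (∀ i → x i < a) → totalExcess a x ≡ 0ℤ
totalExcess-above {n} x x<a = ≡-trans (sumOver-cong _ _ ⊤ (λ i _ → excess-below (x<a i))) (sumOver-zero {n} ⊤)

totalExcess-cong : ∀ {n} a (y m : Vector ℤ n) →
                   (∀ j → a ≤ j → #≥ (toList y) j ≡ #≥ (toList m) j) → totalExcess a y ≡ totalExcess a m
totalExcess-cong a y m agree = below-bound ∣ U - a ∣ a U≤a+∣U-a∣ agree
  where
  U : ℤ
  U = (max y ⊔ max m) + 1ℤ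
  regroup : ∀ u a → u ≡ a + (u - a)
  regroup = solve-∀
  U≤a+∣U-a∣ : U ≤ a + ℤ.+ ∣ U - a ∣
  U≤a+∣U-a∣ = ℤₚ.≤-trans (ℤₚ.≤-reflexive (regroup U a)) (ℤₚ.+-monoʳ-≤ a (i≤+∣i∣ (U - a)))
  y<U : ∀ i → y i < U
  y<U i = ℤₚ.≤-<-trans (ℤₚ.≤-trans (≤max y i) (ℤₚ.i≤i⊔j (max y) (max m))) (i<i+1 _)
  m<U : ∀ i → m i < U
  m<U i = ℤₚ.≤-<-trans (ℤₚ.≤-trans (≤max m i) (ℤₚ.i≤j⊔i (max y) (max m))) (i<i+1 _)
  below-bound : ∀ k a → U ≤ a + ℤ.+ k → (∀ j → a ≤ j → #≥ (toList y) j ≡ #≥ (toList m) j) →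
                totalExcess a y ≡ totalExcess a m
  below-bound zero a U≤a _ =
    ≡-trans (totalExcess-above y (λ i → ℤₚ.<-≤-trans (y<U i) U≤a′))
            (sym (totalExcess-above m (λ i → ℤₚ.<-≤-trans (m<U i) U≤a′)))
    where
    U≤a′ : U ≤ a
    U≤a′ = subst (U ≤_) (ℤₚ.+-identityʳ a) U≤a
  below-bound (suc k) a U≤a+k+1 agree′ =
    ≡-trans (totalExcess-step a y)
            (≡-trans (cong₂ _+_ (below-bound k (a + 1ℤ) (subst (U ≤_) (reassoc a (ℤ.+ k)) U≤a+k+1)
                                                     (λ j a+1≤j → agree′ j (ℤₚ.≤-trans (ℤₚ.i≤i+j a 1ℤ) a+1≤j)))
                                (agree′ a ℤₚ.≤-refl))
                    (sym (totalExcess-step a m)))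
    where
    reassoc : ∀ a k → a + (1ℤ + k) ≡ (a + 1ℤ) + k
    reassoc = solve-∀

fewerAtLevel⇒sumOver< : ∀ {n} (m y : Vector ℤ n) (C : Subset n) α →
                        (∀ u → α ≤ m u → u ∈ C) → (∀ u → u ∈ C → α ≤ m u + 1ℤ) →
                        #≥ (toList y) α < #≥ (toList m) α →
                        (∀ j → α < j → #≥ (toList y) j ≡ #≥ (toList m) j) →
                        sumOver y C < sumOver m C
fewerAtLevel⇒sumOver< m y C α contains near fewer agree = begin-strict
  sumOver y C                                      ≤⟨ sumOver-mono y _ C (λ i _ → ≤excess α (y i)) ⟩
  sumOver (λ i → (α - 1ℤ) + excess α (y i)) C      ≡⟨ sumOver-+ _ _ C ⟩
  K + sumOver (λ i → excess α (y i)) C             ≤⟨ ℤₚ.+-monoʳ-≤ K (sumOver≤sumOver-⊤ _ C (excess-nonneg α ∘ y)) ⟩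
  K + totalExcess α y                              ≡⟨ cong (K +_) (totalExcess-step α y) ⟩
  K + (totalExcess (α + 1ℤ) y + #≥ (toList y) α)   <⟨ ℤₚ.+-monoʳ-< K (ℤₚ.+-monoʳ-< (totalExcess (α + 1ℤ) y) fewer) ⟩
  K + (totalExcess (α + 1ℤ) y + #≥ (toList m) α)   ≡⟨ cong (λ t → K + (t + #≥ (toList m) α)) agree-above ⟩
  K + (totalExcess (α + 1ℤ) m + #≥ (toList m) α)   ≡⟨ cong (K +_) (sym (totalExcess-step α m)) ⟩
  K + totalExcess α m                              ≡⟨ cong (K +_) (sym (sumOver≡sumOver-⊤ _ C outside-zero)) ⟩
  K + sumOver (λ i → excess α (m i)) C             ≡⟨ sym (sumOver-+ _ _ C) ⟩
  sumOver (λ i → (α - 1ℤ) + excess α (m i)) C      ≡⟨ sumOver-cong _ m C (λ i i∈C → sym (≡excess (near i i∈C))) ⟩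
  sumOver m C                                      ∎
  where
  open ℤₚ.≤-Reasoning
  K : ℤ
  K = sumOver (λ _ → α - 1ℤ) C
  agree-above : totalExcess (α + 1ℤ) y ≡ totalExcess (α + 1ℤ) m
  agree-above = totalExcess-cong (α + 1ℤ) y m (λ j α+1≤j → agree j (+1≤⇒< α+1≤j))
  outside-zero : ∀ i → i ∉ C → excess α (m i) ≡ 0ℤ
  outside-zero i i∉C = excess-below (ℤₚ.≰⇒> (i∉C ∘ contains i))

-- (B) implies (C1) and (C2)

complement-sum : ∀ {n} {b : Subset n → ℤ+∞} {bS y} X → InB b bS y → sumOver y (∁ X) ≡ bS - sumOver y X
complement-sum {y = y} X (total , _) = ≡-trans (sumOver-∁ y X) (cong (_- sumOver y X) total)

compl≤sumOver : ∀ {n} (b : Subset n → ℤ+∞) bS {y} X {z} → InB b bS y → compl b bS X ≡ fin z → z ≤ sumOver y X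
compl≤sumOver b bS {y} X y∈B p≡z with b (∁ X) | proj₂ y∈B (∁ X)
compl≤sumOver b bS {y} X y∈B refl | fin v | fin≤fin y∁≤v = begin
  bS - v                           ≤⟨ ℤₚ.+-monoʳ-≤ bS (ℤₚ.neg-mono-≤ y∁≤v) ⟩
  bS - sumOver y (∁ X)             ≡⟨ cong (λ t → bS - t) (complement-sum X y∈B) ⟩
  bS - (bS - sumOver y X)          ≡⟨ cancel bS (sumOver y X) ⟩
  sumOver y X                      ∎
  where
  open ℤₚ.≤-Reasoning
  cancel : ∀ a b → a - (a - b) ≡ b
  cancel = solve-∀

tight⇒sumOver-∁≤ : ∀ {n} (b : Subset n → ℤ+∞) bS {m y} X → InB b bS m → InB b bS y →
                   IsTight (compl b bS) m X → sumOver y (∁ X) ≤ sumOver m (∁ X)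
tight⇒sumOver-∁≤ b bS {m} {y} X m∈B y∈B tight =
  subst₂ _≤_ (sym (complement-sum X y∈B)) (sym (complement-sum X m∈B))
         (ℤₚ.+-monoʳ-≤ bS (ℤₚ.neg-mono-≤ (compl≤sumOver b bS X y∈B tight)))

∁⊥≡⊤ : ∀ {n} → ∁ (⊥ {n}) ≡ ⊤
∁⊥≡⊤ {zero}  = refl
∁⊥≡⊤ {suc n} = cong (true ∷_) ∁⊥≡⊤

compl-of-fin : ∀ {n} (b : Subset n → ℤ+∞) bS X {v} → b (∁ X) ≡ fin v → compl b bS X ≡ fin (bS - v)
compl-of-fin b bS X b∁X≡v with b (∁ X)
compl-of-fin b bS X refl | fin v = refl

⊥-tight : ∀ {n} (b : Subset n → ℤ+∞) bS (m : Vector ℤ n) → b ⊤ ≡ fin bS → IsTight (compl b bS) m ⊥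
⊥-tight b bS m b⊤≡bS =
  ≡-trans (compl-of-fin b bS ⊥ (≡-trans (cong b ∁⊥≡⊤) b⊤≡bS))
          (cong fin (≡-trans (ℤₚ.+-inverseʳ bS) (sym (sumOver-⊥ m))))

crossing : ∀ ℓ (P : Fin (suc ℓ) → Set) → (∀ k → Dec (P k)) → ¬ P zero → P (fromℕ ℓ) →
           ∃ λ (i : Fin ℓ) → ¬ P (inject₁ i) × P (suc i)
crossing zero    P P? ¬P₀ Pℓ = contradiction Pℓ ¬P₀
crossing (suc ℓ) P P? ¬P₀ Pℓ with P? (suc zero)
... | yes P₁ = zero , ¬P₀ , P₁
... | no ¬P₁ with crossing ℓ (P ∘ suc) (P? ∘ suc) ¬P₁ Pℓ
...   | i , ¬Pi , Pi+1 = suc i , ¬Pi , Pi+1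

∃-outside : ∀ {n} {P : Fin n → Set} → (∀ u → Dec (P u)) → (X : Subset n) →
            ¬ (∀ u → P u → u ∈ X) → ∃ λ w → P w × w ∉ X
∃-outside {n} {P} P? X ¬P⊆X with Finₚ.¬∀⟶∃¬ n (λ u → P u → u ∈ X) (λ u → P? u →-dec (u ∈? X)) ¬P⊆X
... | w , ¬Pw⇒w∈X with P? w
...   | yes Pw = w , Pw , λ w∈X → ¬Pw⇒w∈X (λ _ → w∈X)
...   | no ¬Pw = contradiction (λ Pw → contradiction Pw ¬Pw) ¬Pw⇒w∈X

layer-lower-bound : ∀ {n} {m : Vector ℤ n} {E C w} → IsTop m E → NearUniformOn m (C ─ E) →
                    w ∈ C → w ∉ E → ∀ u → u ∈ C → m w ≤ m u + 1ℤ
layer-lower-bound {m = m} {E} {w = w} top near w∈C w∉E u u∈C with u ∈? E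
... | yes u∈E = ℤₚ.≤-trans (top u w u∈E w∉E) (ℤₚ.i≤i+j (m u) 1ℤ)
... | no  u∉E = near w u (x∈p∧x∉q⇒x∈p─q w∈C w∉E) (x∈p∧x∉q⇒x∈p─q u∈C u∉E)

layer-upper-bound : ∀ {n} {m : Vector ℤ n} {E C w} → IsTop m C → NearUniformOn m (C ─ E) →
                    w ∈ C → w ∉ E → ∀ u → u ∉ E → m u ≤ m w + 1ℤ
layer-upper-bound {m = m} {C = C} {w} top near w∈C w∉E u u∉E with u ∈? C
... | yes u∈C = near u w (x∈p∧x∉q⇒x∈p─q u∈C u∉E) (x∈p∧x∉q⇒x∈p─q w∈C w∉E)
... | no  u∉C = ℤₚ.≤-trans (top w u w∈C u∉C) (ℤₚ.i≤i+j (m w) 1ℤ)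

count-pos : ∀ {n} {P : ℤ → Set} (P? : ∀ v → Dec (P v)) (x : Vector ℤ n) →
            0ℤ < count (λ v → does (P? v)) (toList x) → ∃ λ i → P (x i)
count-pos {zero}  P? x 0<0 = contradiction 0<0 (ℤₚ.<-irrefl refl)
count-pos {suc n} P? x 0<count with P? (x zero)
... | yes Px₀ = zero , Px₀
... | no  _   with count-pos P? (x ∘ suc) (subst (0ℤ <_) (ℤₚ.+-identityˡ _) 0<count)
...   | i , Pxi = suc i , Pxi

neg-swap-≤ : ∀ {i j} → i ≤ - j → j ≤ - i
neg-swap-≤ {i} {j} i≤-j = subst (_≤ - i) (ℤₚ.neg-involutive j) (ℤₚ.neg-mono-≤ i≤-j)

atLeast-neg : ∀ j v → atLeast j (- v) ≡ atMost (- j) v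
atLeast-neg j v with j ≤? - v | v ≤? - j
... | yes _      | yes _      = refl
... | yes j≤-v   | no  v≰-j   = contradiction (neg-swap-≤ j≤-v) v≰-j
... | no  j≰-v   | yes v≤-j   = contradiction (neg-swap-≤ v≤-j) j≰-v
... | no  _      | no  _      = refl

#≥-neg : ∀ {n} (x : Vector ℤ n) j → #≥ (toList (λ i → - x i)) j ≡ #≤ (toList x) (- j)
#≥-neg x j = count-cong (atLeast j) (atMost (- j)) (λ i → - x i) x (λ i → atLeast-neg j (x i))

chain-top : ∀ {n ℓ} {m : Vector ℤ n} (C : Fin (suc ℓ) → Subset n) → C zero ≡ ⊥ →
            (∀ i → IsTop m (C (suc i))) → ∀ k → IsTop m (C k)
chain-top C C₀≡⊥ top zero    u _ u∈C₀ _ = contradiction (subst (u ∈_) C₀≡⊥ u∈C₀) ∉⊥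
chain-top C C₀≡⊥ top (suc k) = top k

chain-tight : ∀ {n ℓ} (b : Subset n → ℤ+∞) bS {m : Vector ℤ n} (C : Fin (suc ℓ) → Subset n) →
              b ⊤ ≡ fin bS → C zero ≡ ⊥ → (∀ i → IsTight (compl b bS) m (C (suc i))) →
              ∀ k → IsTight (compl b bS) m (C k)
chain-tight b bS {m} C b⊤≡bS C₀≡⊥ tight zero    =
  subst (IsTight (compl b bS) m) (sym C₀≡⊥) (⊥-tight b bS m b⊤≡bS)
chain-tight b bS     C b⊤≡bS C₀≡⊥ tight (suc k) = tight k

CondB⇒DecMin : ∀ {n} (b : Subset n → ℤ+∞) bS (m : Vector ℤ n) → CondB b bS m → DecMin b bS m
CondB⇒DecMin {n} b bS m (ℓ , C , C₀≡⊥ , Cℓ≡⊤ , _ , top , tight , near) y y∈B with dec-≤lex⊎lastDifference m y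
... | inj₁ m≤y = m≤y
... | inj₂ (α , fewer , agree) = contradiction
  (compl≤sumOver b bS (C (suc i)) y∈B (tight i))
  (ℤₚ.<⇒≱ (fewerAtLevel⇒sumOver< m y (C (suc i)) α (proj₂ (proj₂ layer)) near′ fewer agree))
  where
  Covers : Fin (suc ℓ) → Set
  Covers k = ∀ u → α ≤ m u → u ∈ C k
  ¬covers₀ : ¬ Covers zero
  ¬covers₀ covers₀ with count-pos (α ≤?_) m (ℤₚ.≤-<-trans (count-nonneg (atLeast α) (toList y)) fewer)
  ... | w₀ , α≤mw₀ = ∉⊥ (subst (w₀ ∈_) C₀≡⊥ (covers₀ w₀ α≤mw₀))
  coversℓ : Covers (fromℕ ℓ)
  coversℓ u _ = subst (u ∈_) (sym Cℓ≡⊤) ∈⊤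
  layer : ∃ λ (i : Fin ℓ) → ¬ Covers (inject₁ i) × Covers (suc i)
  layer = crossing ℓ Covers (λ k → Finₚ.all? (λ u → (α ≤? m u) →-dec (u ∈? C k))) ¬covers₀ coversℓ
  i : Fin ℓ
  i = proj₁ layer
  missed : ∃ λ w → α ≤ m w × w ∉ C (inject₁ i)
  missed = ∃-outside (λ u → α ≤? m u) (C (inject₁ i)) (proj₁ (proj₂ layer))
  w : Fin n
  w = proj₁ missed
  α≤mw : α ≤ m w
  α≤mw = proj₁ (proj₂ missed)
  near′ : ∀ u → u ∈ C (suc i) → α ≤ m u + 1ℤ
  near′ u u∈C = ℤₚ.≤-trans α≤mw
    (layer-lower-bound (chain-top C C₀≡⊥ top (inject₁ i)) (near i) (proj₂ (proj₂ layer) w α≤mw) (proj₂ (proj₂ missed)) u u∈C)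

CondB⇒IncMax : ∀ {n} (b : Subset n → ℤ+∞) bS (m : Vector ℤ n) → b ⊤ ≡ fin bS → InB b bS m →
               CondB b bS m → IncMax b bS m
CondB⇒IncMax {n} b bS m b⊤≡bS m∈B (ℓ , C , C₀≡⊥ , Cℓ≡⊤ , _ , top , tight , near) y y∈B
  with inc-≤lex⊎firstDifference m y
... | inj₁ y≤m = y≤m
... | inj₂ (β , fewer , agree) = contradiction
  (tight⇒sumOver-∁≤ b bS E m∈B y∈B (chain-tight b bS C b⊤≡bS C₀≡⊥ tight (inject₁ i)))
  (ℤₚ.<⇒≱ (ℤₚ.neg-cancel-< (subst₂ _<_ (sumOver-neg y (∁ E)) (sumOver-neg m (∁ E)) negated)))
  where
  Avoids : Fin (suc ℓ) → Set
  Avoids k = ∀ u → m u ≤ β → u ∈ ∁ (C k)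
  avoids? : ∀ k → Dec (Avoids k)
  avoids? k = Finₚ.all? (λ u → (m u ≤? β) →-dec (u ∈? ∁ (C k)))
  avoids₀ : Avoids zero
  avoids₀ u _ = x∉p⇒x∈∁p (λ u∈C₀ → ∉⊥ (subst (u ∈_) C₀≡⊥ u∈C₀))
  ¬avoidsℓ : ¬ Avoids (fromℕ ℓ)
  ¬avoidsℓ avoidsℓ with count-pos (_≤? β) m (ℤₚ.≤-<-trans (count-nonneg (atMost β) (toList y)) fewer)
  ... | w₀ , mw₀≤β = x∈∁p⇒x∉p (avoidsℓ w₀ mw₀≤β) (subst (w₀ ∈_) (sym Cℓ≡⊤) ∈⊤)
  layer : ∃ λ (i : Fin ℓ) → ¬ ¬ Avoids (inject₁ i) × ¬ Avoids (suc i)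
  layer = crossing ℓ (¬_ ∘ Avoids) (¬? ∘ avoids?) (λ ¬avoids₀ → ¬avoids₀ avoids₀) ¬avoidsℓ
  i : Fin ℓ
  i = proj₁ layer
  E : Subset n
  E = C (inject₁ i)
  avoids : Avoids (inject₁ i)
  avoids = decidable-stable (avoids? (inject₁ i)) (proj₁ (proj₂ layer))
  hit : ∃ λ w → m w ≤ β × w ∉ ∁ (C (suc i))
  hit = ∃-outside (λ u → m u ≤? β) (∁ (C (suc i))) (proj₂ (proj₂ layer))
  w : Fin n
  w = proj₁ hit
  mw≤β : m w ≤ β
  mw≤β = proj₁ (proj₂ hit)
  mu≤β+1 : ∀ u → u ∈ ∁ E → m u ≤ β + 1ℤ
  mu≤β+1 u u∈∁E = ℤₚ.≤-trans
    (layer-upper-bound (top i) (near i) (x∉∁p⇒x∈p (proj₂ (proj₂ hit))) (x∈∁p⇒x∉p (avoids w mw≤β)) u (x∈∁p⇒x∉p u∈∁E))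
    (ℤₚ.+-monoˡ-≤ 1ℤ mw≤β)
  negated : sumOver (λ i → - y i) (∁ E) < sumOver (λ i → - m i) (∁ E)
  negated = fewerAtLevel⇒sumOver< (λ i → - m i) (λ i → - y i) (∁ E) (- β)
    (λ u -β≤-mu → avoids u (ℤₚ.neg-cancel-≤ -β≤-mu))
    (λ u u∈∁E → subst (_≤ - m u + 1ℤ) (regroup β) (ℤₚ.+-monoˡ-≤ 1ℤ (ℤₚ.neg-mono-≤ (mu≤β+1 u u∈∁E))))
    (subst₂ _<_ (sym (≡-trans (#≥-neg y (- β)) (cong (#≤ (toList y)) (ℤₚ.neg-involutive β))))
                (sym (≡-trans (#≥-neg m (- β)) (cong (#≤ (toList m)) (ℤₚ.neg-involutive β)))) fewer)
    (λ j -β<j → ≡-trans (#≥-neg y j)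
                        (≡-trans (agree (- j) (subst (- j <_) (ℤₚ.neg-involutive β) (ℤₚ.neg-mono-< -β<j)))
                                 (sym (#≥-neg m j))))
    where
    regroup : ∀ b → - (b + 1ℤ) + 1ℤ ≡ - b
    regroup = solve-∀

-- (C1) and (C2) imply (A)

shift-source : ∀ {n} (m : Vector ℤ n) {s t} → s ≢ t → shift m s t s ≡ m s + 1ℤ
shift-source m {s} {t} s≢t rewrite dec-true (s ≟ s) refl | dec-false (t ≟ s) (s≢t ∘ sym) = ℤₚ.+-identityʳ (m s + 1ℤ)

shift-target : ∀ {n} (m : Vector ℤ n) {s t} → s ≢ t → shift m s t t ≡ m t - 1ℤ
shift-target m {s} {t} s≢t rewrite dec-false (s ≟ t) s≢t | dec-true (t ≟ t) refl = cong (_- 1ℤ) (ℤₚ.+-identityʳ (m t))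

shift-other : ∀ {n} (m : Vector ℤ n) {s t i} → i ≢ s → i ≢ t → shift m s t i ≡ m i
shift-other m {s} {t} {i} i≢s i≢t rewrite dec-false (s ≟ i) (i≢s ∘ sym) | dec-false (t ≟ i) (i≢t ∘ sym) =
  ≡-trans (ℤₚ.+-identityʳ (m i + 0ℤ)) (ℤₚ.+-identityʳ (m i))

shift-pointwise : ∀ {n} (R : ℤ → ℤ → Set) (m : Vector ℤ n) {s t} → s ≢ t → (∀ v → R v v) →
                  R (m s + 1ℤ) (m s) → R (m t - 1ℤ) (m t) → ∀ i → R (shift m s t i) (m i)
shift-pointwise R m {s} {t} s≢t R-refl Rs Rt i with i ≟ s | i ≟ t
... | yes refl | _        = subst (λ v → R v (m s)) (sym (shift-source m s≢t)) Rs
... | no  _    | yes refl = subst (λ v → R v (m t)) (sym (shift-target m s≢t)) Rt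
... | no  i≢s  | no  i≢t  = subst (λ v → R v (m i)) (sym (shift-other m i≢s i≢t)) (R-refl (m i))

DecMin⇒CondA : ∀ {n} (b : Subset n → ℤ+∞) bS (m : Vector ℤ n) → DecMin b bS m → CondA b bS m
DecMin⇒CondA b bS m m-min s t ms+1<mt y∈B = lastDifference⇒dec-≰lex m y (m t , fewer , agree) (m-min y y∈B)
  where
  y : Vector ℤ _
  y = shift m s t
  ms<mt : m s < m t
  ms<mt = ℤₚ.<-trans (i<i+1 (m s)) ms+1<mt
  s≢t : s ≢ t
  s≢t refl = ℤₚ.<-irrefl refl ms<mt
  fewer : #≥ (toList y) (m t) < #≥ (toList m) (m t)
  fewer = count-< (atLeast (m t)) y m t
    (shift-pointwise (λ v w → indicator (atLeast (m t) v) ≤ indicator (atLeast (m t) w)) m s≢t (λ _ → ℤₚ.≤-refl)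
      (false⇒indicator≤ (atLeast-below ms+1<mt) _)
      (false⇒indicator≤ (atLeast-below (i-1<i (m t))) _))
    (≡-trans (cong (atLeast (m t)) (shift-target m s≢t)) (atLeast-below (i-1<i (m t))))
    (dec-true (m t ≤? m t) ℤₚ.≤-refl)
  agree : ∀ j → m t < j → #≥ (toList y) j ≡ #≥ (toList m) j
  agree j mt<j = count-cong (atLeast j) (atLeast j) y m
    (shift-pointwise (λ v w → atLeast j v ≡ atLeast j w) m s≢t (λ _ → refl)
      (≡-trans (atLeast-below (ℤₚ.<-trans ms+1<mt mt<j)) (sym (atLeast-below (ℤₚ.<-trans ms<mt mt<j))))
      (≡-trans (atLeast-below (ℤₚ.<-trans (i-1<i (m t)) mt<j)) (sym (atLeast-below mt<j))))

IncMax⇒CondA : ∀ {n} (b : Subset n → ℤ+∞) bS (m : Vector ℤ n) → IncMax b bS m → CondA b bS m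
IncMax⇒CondA b bS m m-max s t ms+1<mt y∈B = firstDifference⇒inc-≰lex m y (m s , fewer , agree) (m-max y y∈B)
  where
  y : Vector ℤ _
  y = shift m s t
  ms<mt-1 : m s < m t - 1ℤ
  ms<mt-1 = ℤₚ.<-≤-trans (i<i+1 (m s)) (<⇒≤-1 ms+1<mt)
  s≢t : s ≢ t
  s≢t refl = ℤₚ.<-irrefl refl (ℤₚ.<-trans ms<mt-1 (i-1<i (m s)))
  fewer : #≤ (toList y) (m s) < #≤ (toList m) (m s)
  fewer = count-< (atMost (m s)) y m s
    (shift-pointwise (λ v w → indicator (atMost (m s) v) ≤ indicator (atMost (m s) w)) m s≢t (λ _ → ℤₚ.≤-refl)
      (false⇒indicator≤ (atMost-above (i<i+1 (m s))) _)
      (false⇒indicator≤ (atMost-above ms<mt-1) _))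
    (≡-trans (cong (atMost (m s)) (shift-source m s≢t)) (atMost-above (i<i+1 (m s))))
    (dec-true (m s ≤? m s) ℤₚ.≤-refl)
  agree : ∀ j → j < m s → #≤ (toList y) j ≡ #≤ (toList m) j
  agree j j<ms = count-cong (atMost j) (atMost j) y m
    (shift-pointwise (λ v w → atMost j v ≡ atMost j w) m s≢t (λ _ → refl)
      (≡-trans (atMost-above (ℤₚ.<-trans j<ms (i<i+1 (m s)))) (sym (atMost-above j<ms)))
      (≡-trans (atMost-above (ℤₚ.<-trans j<ms ms<mt-1))
               (sym (atMost-above (ℤₚ.<-trans j<ms (ℤₚ.<-trans ms<mt-1 (i-1<i (m t))))))))

-- (A) implies (B)

-- CondB b bS m unfolds to ChainFrom m (compl b bS) ⊥.
ChainFrom : ∀ {n} → Vector ℤ n → (Subset n → ℤ-∞) → Subset n → Set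
ChainFrom {n} m p start =
  Σ ℕ λ ℓ → Σ (Fin (suc ℓ) → Subset n) λ C →
    (C zero ≡ start) × (C (fromℕ ℓ) ≡ ⊤) ×
    (∀ (i : Fin ℓ) → C (inject₁ i) ⊂ C (suc i)) ×
    (∀ (i : Fin ℓ) → IsTop m (C (suc i))) ×
    (∀ (i : Fin ℓ) → IsTight p m (C (suc i))) ×
    (∀ (i : Fin ℓ) → NearUniformOn m (C (suc i) ─ C (inject₁ i)))

chain-⊤ : ∀ {n} {m : Vector ℤ n} {p} → ChainFrom m p ⊤
chain-⊤ = 0 , (λ _ → ⊤) , refl , refl , (λ ()) , (λ ()) , (λ ()) , (λ ())

chain-∷ : ∀ {n} {m : Vector ℤ n} {p start X} → start ⊂ X → IsTop m X → IsTight p m X →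
          NearUniformOn m (X ─ start) → ChainFrom m p X → ChainFrom m p start
chain-∷ {n} {m} {p} {start} start⊂X top tight near (ℓ , C , C₀≡X , Cℓ≡⊤ , ⊂-steps , tops , tights , nears) =
  suc ℓ , C′ , refl , Cℓ≡⊤ , ⊂-steps′ , tops′ , tights′ , nears′
  where
  C′ : Fin (suc (suc ℓ)) → Subset n
  C′ zero    = start
  C′ (suc i) = C i
  ⊂-steps′ : ∀ i → C′ (inject₁ i) ⊂ C′ (suc i)
  ⊂-steps′ zero    = subst (start ⊂_) (sym C₀≡X) start⊂X
  ⊂-steps′ (suc i) = ⊂-steps i
  tops′ : ∀ i → IsTop m (C′ (suc i))
  tops′ zero    = subst (IsTop m) (sym C₀≡X) top
  tops′ (suc i) = tops i
  tights′ : ∀ i → IsTight p m (C′ (suc i))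
  tights′ zero    = subst (IsTight p m) (sym C₀≡X) tight
  tights′ (suc i) = tights i
  nears′ : ∀ i → NearUniformOn m (C′ (suc i) ─ C′ (inject₁ i))
  nears′ zero    = subst (λ Y → NearUniformOn m (Y ─ start)) (sym C₀≡X) near
  nears′ (suc i) = nears i

data WeakChainFrom {n} (m : Vector ℤ n) (p : Subset n → ℤ-∞) (start : Subset n) : List (Subset n) → Set where
  done : start ≡ ⊤ → WeakChainFrom m p start []
  step : ∀ {X Xs} → start ⊆ X → IsTop m X → IsTight p m X → NearUniformOn m (X ─ start) →
         WeakChainFrom m p X Xs → WeakChainFrom m p start (X ∷ Xs)

weak⇒chain : ∀ {n} {m : Vector ℤ n} {p start Xs} → WeakChainFrom m p start Xs → ChainFrom m p start
weak⇒chain {p = p} (done refl) = chain-⊤ {p = p}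
weak⇒chain {m = m} {p} {start} (step {X} start⊆X top tight near rest)
  with Finₚ.any? (λ x → (x ∈? X) ×-dec ¬? (x ∈? start))
... | yes new = chain-∷ (start⊆X , new) top tight near (weak⇒chain rest)
... | no ¬new = subst (ChainFrom m p) (⊆-antisym X⊆start start⊆X) (weak⇒chain rest)
  where
  X⊆start : X ⊆ start
  X⊆start {x} x∈X = decidable-stable (x ∈? start) (λ x∉start → ¬new (x , x∈X , x∉start))

_≤∞?_ : ∀ x y → Dec (x ≤∞ y)
fin a ≤∞? fin c with a ≤? c
... | yes a≤c = yes (fin≤fin a≤c)
... | no  a≰c = no λ { (fin≤fin a≤c) → a≰c a≤c }
x     ≤∞? +∞    = yes ≤+∞
+∞    ≤∞? fin c = no λ ()

squeeze : ∀ {A C : ℤ+∞} {a c} → (A +∞+ C) ≤∞ fin (a + c) → fin a ≤∞ A → fin c ≤∞ C → A ≡ fin a × C ≡ fin c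
squeeze {fin a′} {fin c′} {a} {c} (fin≤fin sum≤) (fin≤fin a≤a′) (fin≤fin c≤c′) =
  cong fin (ℤₚ.≤-antisym a′≤a a≤a′) , cong fin (ℤₚ.≤-antisym c′≤c c≤c′)
  where
  cancelʳ : ∀ x y → (x + y) - y ≡ x
  cancelʳ = solve-∀
  cancelˡ : ∀ x y → (x + y) - x ≡ y
  cancelˡ = solve-∀
  a′≤a : a′ ≤ a
  a′≤a = subst₂ _≤_ (cancelʳ a′ c′) (cancelʳ a c′)
    (ℤₚ.+-monoˡ-≤ (- c′) (ℤₚ.≤-trans sum≤ (ℤₚ.+-monoʳ-≤ a c≤c′)))
  c′≤c : c′ ≤ c
  c′≤c = subst₂ _≤_ (cancelˡ a′ c′) (cancelˡ a′ c)
    (ℤₚ.+-monoˡ-≤ (- a′) (ℤₚ.≤-trans sum≤ (ℤₚ.+-monoˡ-≤ c a≤a′)))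

shift-violation : ∀ (bZ : ℤ+∞) a cu ct → fin a ≤∞ bZ → ¬ (fin ((a + indicator cu) - indicator ct) ≤∞ bZ) →
                  bZ ≡ fin a × cu ≡ true × ct ≡ false
shift-violation +∞ a cu ct _ violated = contradiction ≤+∞ violated
shift-violation (fin v) a true false (fin≤fin a≤v) violated =
  cong fin (ℤₚ.≤-antisym v≤a a≤v) , refl , refl
  where
  v≤a : v ≤ a
  v≤a = subst (v ≤_) (+1-cancel a)
    (<⇒≤-1 (subst (v <_) (ℤₚ.+-identityʳ (a + 1ℤ)) (ℤₚ.≰⇒> (violated ∘ fin≤fin))))
shift-violation (fin v) a true true (fin≤fin a≤v) violated =
  contradiction (fin≤fin (subst (_≤ v) (sym (+1-cancel a)) a≤v)) violated
shift-violation (fin v) a false false (fin≤fin a≤v) violated =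
  contradiction (fin≤fin (subst (_≤ v) (sym (≡-trans (ℤₚ.+-identityʳ (a + 0ℤ)) (ℤₚ.+-identityʳ a))) a≤v)) violated
shift-violation (fin v) a false true (fin≤fin a≤v) violated =
  contradiction (fin≤fin (ℤₚ.≤-trans (ℤₚ.<⇒≤ (i-1<i (a + 0ℤ))) (subst (_≤ v) (sym (ℤₚ.+-identityʳ a)) a≤v)))
                violated

sumOver-shift : ∀ {n} (m : Vector ℤ n) s t X →
                sumOver (shift m s t) X ≡ (sumOver m X + indicator (lookup X s)) - indicator (lookup X t)
sumOver-shift m s t X =
  ≡-trans (sumOver-+ (λ i → m i + χ s i) (λ i → - χ t i) X)
          (cong₂ _+_ (≡-trans (sumOver-+ m (χ s) X) (cong (sumOver m X +_) (sumOver-χ s X)))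
                     (≡-trans (sumOver-neg (χ t) X) (cong -_ (sumOver-χ t X))))

⋃ᶠ : ∀ {n k} → (Fin k → Subset n) → Subset n
⋃ᶠ {k = zero}  F = ⊥
⋃ᶠ {k = suc k} F = F zero ∪ ⋃ᶠ (F ∘ suc)

⋂ᶠ : ∀ {n k} → (Fin k → Subset n) → Subset n
⋂ᶠ {k = zero}  F = ⊤
⋂ᶠ {k = suc k} F = F zero ∩ ⋂ᶠ (F ∘ suc)

∈⋃ᶠ : ∀ {n k} (F : Fin k → Subset n) {x} j → x ∈ F j → x ∈ ⋃ᶠ F
∈⋃ᶠ F zero    x∈F₀ = x∈p∪q⁺ (inj₁ x∈F₀)
∈⋃ᶠ F (suc j) x∈Fj = x∈p∪q⁺ (inj₂ (∈⋃ᶠ (F ∘ suc) j x∈Fj))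

∉⋃ᶠ : ∀ {n k} (F : Fin k → Subset n) {x} → (∀ j → x ∉ F j) → x ∉ ⋃ᶠ F
∉⋃ᶠ {k = zero}  F x∉F x∈⋃ = ∉⊥ x∈⋃
∉⋃ᶠ {k = suc k} F x∉F x∈⋃ with x∈p∪q⁻ (F zero) (⋃ᶠ (F ∘ suc)) x∈⋃
... | inj₁ x∈F₀ = x∉F zero x∈F₀
... | inj₂ x∈⋃′ = ∉⋃ᶠ (F ∘ suc) (x∉F ∘ suc) x∈⋃′

∈⋂ᶠ : ∀ {n k} (F : Fin k → Subset n) {x} → (∀ j → x ∈ F j) → x ∈ ⋂ᶠ F
∈⋂ᶠ {k = zero}  F x∈F = ∈⊤
∈⋂ᶠ {k = suc k} F x∈F = x∈p∩q⁺ (x∈F zero , ∈⋂ᶠ (F ∘ suc) (x∈F ∘ suc))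

⋂ᶠ-∈ : ∀ {n k} (F : Fin k → Subset n) {x} j → x ∈ ⋂ᶠ F → x ∈ F j
⋂ᶠ-∈ F zero    x∈⋂ = proj₁ (x∈p∩q⁻ _ _ x∈⋂)
⋂ᶠ-∈ F (suc j) x∈⋂ = ⋂ᶠ-∈ (F ∘ suc) j (proj₂ (x∈p∩q⁻ _ _ x∈⋂))

∁-involutive : ∀ {n} (X : Subset n) → ∁ (∁ X) ≡ X
∁-involutive []          = refl
∁-involutive (true ∷ X)  = cong (true ∷_) (∁-involutive X)
∁-involutive (false ∷ X) = cong (false ∷_) (∁-involutive X)

x∈p─q⇒x∉q : ∀ {n} {x : Fin n} (p q : Subset n) → x ∈ p ─ q → x ∉ q
x∈p─q⇒x∉q (_ ∷ p) (false ∷ q) here      = λ ()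
x∈p─q⇒x∉q (_ ∷ p) (_ ∷ q)     (there x∈) = x∈p─q⇒x∉q p q x∈ ∘ drop-there

module TightSets {n} (b : Subset n → ℤ+∞) (bS : ℤ) (submodular : Submodular b)
                 (b⊥≡0 : b ⊥ ≡ fin 0ℤ) (b⊤≡bS : b ⊤ ≡ fin bS) (m : Vector ℤ n) (m∈B : InB b bS m) where

  Tight : Subset n → Set
  Tight Z = b Z ≡ fin (sumOver m Z)

  ⊥-Tight : Tight ⊥
  ⊥-Tight = ≡-trans b⊥≡0 (cong fin (sym (sumOver-⊥ m)))

  ⊤-Tight : Tight ⊤
  ⊤-Tight = ≡-trans b⊤≡bS (cong fin (sym (proj₁ m∈B)))

  ∩∪-Tight : ∀ {X Y} → Tight X → Tight Y → Tight (X ∩ Y) × Tight (X ∪ Y)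
  ∩∪-Tight {X} {Y} X-tight Y-tight = squeeze
    (subst ((b (X ∩ Y) +∞+ b (X ∪ Y)) ≤∞_)
           (≡-trans (cong₂ _+∞+_ X-tight Y-tight) (cong fin (sym (sumOver-∩∪ m X Y))))
           (submodular X Y))
    (proj₂ m∈B (X ∩ Y)) (proj₂ m∈B (X ∪ Y))

  ⋃ᶠ-Tight : ∀ {k} (F : Fin k → Subset n) → (∀ j → Tight (F j)) → Tight (⋃ᶠ F)
  ⋃ᶠ-Tight {zero}  F _       = ⊥-Tight
  ⋃ᶠ-Tight {suc k} F F-tight = proj₂ (∩∪-Tight (F-tight zero) (⋃ᶠ-Tight (F ∘ suc) (F-tight ∘ suc)))

  ⋂ᶠ-Tight : ∀ {k} (F : Fin k → Subset n) → (∀ j → Tight (F j)) → Tight (⋂ᶠ F)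
  ⋂ᶠ-Tight {zero}  F _       = ⊤-Tight
  ⋂ᶠ-Tight {suc k} F F-tight = proj₁ (∩∪-Tight (F-tight zero) (⋂ᶠ-Tight (F ∘ suc) (F-tight ∘ suc)))

  ∁-Tight : ∀ {Z} → Tight Z → IsTight (compl b bS) m (∁ Z)
  ∁-Tight {Z} Z-tight =
    ≡-trans (compl-of-fin b bS (∁ Z) (≡-trans (cong b (∁-involutive Z)) Z-tight))
            (cong fin (sym (complement-sum Z m∈B)))

  module Levels (condA : CondA b bS m) where

    separating-set : ∀ u t → m u + 1ℤ < m t → ∃ λ Z → Tight Z × u ∈ Z × t ∉ Z
    separating-set u t mu+1<mt with anySubset? (λ Z → ¬? (fin (sumOver (shift m u t) Z) ≤∞? b Z))
    ... | yes (Z , violated) with shift-violation (b Z) (sumOver m Z) (lookup Z u) (lookup Z t) (proj₂ m∈B Z)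
                                    (violated ∘ subst (λ v → fin v ≤∞ b Z) (sym (sumOver-shift m u t Z)))
    ...   | Z-tight , Zu≡true , Zt≡false =
      Z , Z-tight , Vecₚ.lookup⇒[]= u Z Zu≡true , λ t∈Z → contradiction (≡-trans (sym Zt≡false) (Vecₚ.[]=⇒lookup t∈Z)) λ ()
    separating-set u t mu+1<mt | no ¬violated = contradiction shifted∈B (condA u t mu+1<mt)
      where
      total : sumOver (shift m u t) ⊤ ≡ bS
      total = ≡-trans (sumOver-shift m u t ⊤)
        (≡-trans (cong₂ (λ cu ct → (sumOver m ⊤ + indicator cu) - indicator ct)
                        (Vecₚ.lookup-replicate u true) (Vecₚ.lookup-replicate t true))
                 (≡-trans (+1-cancel (sumOver m ⊤)) (proj₁ m∈B)))
      shifted∈B : InB b bS (shift m u t)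
      shifted∈B = total , λ Z → decidable-stable (_ ≤∞? b Z) (λ ¬≤ → ¬violated (Z , ¬≤))

    separator : ∀ u t → ∃ λ Z → Tight Z × t ∉ Z × (m u + 1ℤ < m t → u ∈ Z)
    separator u t with m u + 1ℤ <? m t
    ... | yes mu+1<mt with separating-set u t mu+1<mt
    ...   | Z , Z-tight , u∈Z , t∉Z = Z , Z-tight , t∉Z , λ _ → u∈Z
    separator u t | no ¬mu+1<mt = ⊥ , ⊥-Tight , ∉⊥ , λ mu+1<mt → contradiction mu+1<mt ¬mu+1<mt

    Q : Fin n → Subset n
    Q t = ⋃ᶠ (λ u → proj₁ (separator u t))

    Q-Tight : ∀ t → Tight (Q t)
    Q-Tight t = ⋃ᶠ-Tight _ (λ u → proj₁ (proj₂ (separator u t)))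

    ∉Q : ∀ t → t ∉ Q t
    ∉Q t = ∉⋃ᶠ _ (λ u → proj₁ (proj₂ (proj₂ (separator u t))))

    ∈Q : ∀ u t → m u + 1ℤ < m t → u ∈ Q t
    ∈Q u t mu+1<mt = ∈⋃ᶠ (λ u → proj₁ (separator u t)) u (proj₂ (proj₂ (proj₂ (separator u t))) mu+1<mt)

    R : ℤ → Subset n
    R l = ⋂ᶠ (λ t → if atLeast l (m t) then Q t else ⊤)

    C : ℤ → Subset n
    C l = ∁ (R l)

    C-tight : ∀ l → IsTight (compl b bS) m (C l)
    C-tight l = ∁-Tight (⋂ᶠ-Tight _ guarded)
      where
      guarded : ∀ t → Tight (if atLeast l (m t) then Q t else ⊤)
      guarded t with atLeast l (m t)
      ... | true  = Q-Tight t
      ... | false = ⊤-Tight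

    ∈C : ∀ {l t} → l ≤ m t → t ∈ C l
    ∈C {l} {t} l≤mt = x∉p⇒x∈∁p λ t∈R →
      ∉Q t (subst (λ c → t ∈ (if c then Q t else ⊤)) (dec-true (l ≤? m t) l≤mt) (⋂ᶠ-∈ _ t t∈R))

    C-lower : ∀ {l u} → u ∈ C l → l ≤ m u + 1ℤ
    C-lower {l} {u} u∈C with l ≤? m u + 1ℤ
    ... | yes l≤mu+1 = l≤mu+1
    ... | no  l≰mu+1 = contradiction (∈⋂ᶠ _ guarded) (x∈∁p⇒x∉p u∈C)
      where
      guarded : ∀ t → u ∈ (if atLeast l (m t) then Q t else ⊤)
      guarded t with l ≤? m t
      ... | yes l≤mt = ∈Q u t (ℤₚ.<-≤-trans (ℤₚ.≰⇒> l≰mu+1) l≤mt)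
      ... | no  _    = ∈⊤

    C-antitone : ∀ {l l′} → l ≤ l′ → C l′ ⊆ C l
    C-antitone {l} {l′} l≤l′ {u} u∈Cl′ =
      x∉p⇒x∈∁p λ u∈Rl → x∈∁p⇒x∉p u∈Cl′ (∈⋂ᶠ _ (λ t → weaken t (⋂ᶠ-∈ _ t u∈Rl)))
      where
      weaken : ∀ t → u ∈ (if atLeast l (m t) then Q t else ⊤) → u ∈ (if atLeast l′ (m t) then Q t else ⊤)
      weaken t u∈ with l′ ≤? m t
      ... | yes l′≤mt =
        subst (λ c → u ∈ (if c then Q t else ⊤)) (dec-true (l ≤? m t) (ℤₚ.≤-trans l≤l′ l′≤mt)) u∈
      ... | no  _     = ∈⊤

    ∉C : ∀ {l v} → v ∉ C l → m v < l
    ∉C {l} {v} v∉C = ℤₚ.≰⇒> (v∉C ∘ ∈C)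

    C-top : ∀ l → IsTop m (C l)
    C-top l u v u∈C v∉C = subst (_≤ m u) (+1-cancel (m v)) (subst (_ ≤_) (+1-cancel (m u))
      (ℤₚ.+-monoˡ-≤ (- 1ℤ) (ℤₚ.≤-trans (<⇒+1≤ (∉C {l} v∉C)) (C-lower {l} u∈C))))

    C-near : ∀ l → NearUniformOn m (C l ─ C (l + 1ℤ))
    C-near l u v u∈ v∈ = ℤₚ.≤-trans mu≤l (C-lower {l} (p─q⊆p _ _ v∈))
      where
      mu≤l : m u ≤ l
      mu≤l = subst (m u ≤_) (+1-cancel l) (<⇒≤-1 (∉C {l + 1ℤ} (x∈p─q⇒x∉q _ _ u∈)))

    lo : ℤ
    lo = - max (λ i → - m i)

    lo≤ : ∀ u → lo ≤ m u
    lo≤ u = subst (lo ≤_) (ℤₚ.neg-involutive (m u)) (ℤₚ.neg-mono-≤ (≤max (λ i → - m i) u))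

    level : ℕ → ℤ
    level k = lo + ℤ.+ k

    level-suc : ∀ k → level (suc k) ≡ level k + 1ℤ
    level-suc k = reassoc lo (ℤ.+ k)
      where
      reassoc : ∀ a k → a + (1ℤ + k) ≡ (a + k) + 1ℤ
      reassoc = solve-∀

    levelSets : ℕ → List (Subset n)
    levelSets zero    = []
    levelSets (suc k) = C (level k) ∷ levelSets k

    weakChain : ∀ k → WeakChainFrom m (compl b bS) (C (level k)) (levelSets k)
    weakChain zero = done (⊆-antisym ⊆⊤ λ {u} _ → ∈C (subst (_≤ m u) (sym (ℤₚ.+-identityʳ lo)) (lo≤ u)))
    weakChain (suc k) =
      step (C-antitone (subst (level k ≤_) (sym (level-suc k)) (ℤₚ.i≤i+j (level k) 1ℤ)))
           (C-top (level k)) (C-tight (level k))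
           (subst (λ l → NearUniformOn m (C (level k) ─ C l)) (sym (level-suc k)) (C-near (level k)))
           (weakChain k)

    condB : CondB b bS m
    condB = weak⇒chain (step ⊥⊆ (C-top (level K)) (C-tight (level K)) near-top (weakChain K))
      where
      K : ℕ
      K = ∣ max m - lo ∣
      max≤level : max m ≤ level K
      max≤level = ℤₚ.≤-trans (ℤₚ.≤-reflexive (regroup (max m) lo)) (ℤₚ.+-monoʳ-≤ lo (i≤+∣i∣ (max m - lo)))
        where
        regroup : ∀ u a → u ≡ a + (u - a)
        regroup = solve-∀
      near-top : NearUniformOn m (C (level K) ─ ⊥)
      near-top u v _ v∈ = ℤₚ.≤-trans (ℤₚ.≤-trans (≤max m u) max≤level) (C-lower {level K} (p─q⊆p _ _ v∈))

CondA⇒CondB : ∀ {n} (b : Subset n → ℤ+∞) bS → Submodular b → b ⊥ ≡ fin 0ℤ → b ⊤ ≡ fin bS →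
              (m : Vector ℤ n) → InB b bS m → CondA b bS m → CondB b bS m
CondA⇒CondB b bS submodular b⊥≡0 b⊤≡bS m m∈B condA =
  TightSets.Levels.condB b bS submodular b⊥≡0 b⊤≡bS m m∈B condA

theorem3p3 : (n : ℕ) (b : Subset (suc n) → ℤ+∞) (bS : ℤ) →
    Submodular b → b ⊥ ≡ fin 0ℤ → b ⊤ ≡ fin bS →
    (m : Vector ℤ (suc n)) → InB b bS m →
    (CondA b bS m ⇔ CondB b bS m) × (CondB b bS m ⇔ DecMin b bS m) × (DecMin b bS m ⇔ IncMax b bS m)
theorem3p3 n b bS submodular b⊥≡0 b⊤≡bS m m∈B =
  mk⇔ A⇒B (C1⇒A ∘ B⇒C1) , mk⇔ B⇒C1 (A⇒B ∘ C1⇒A) , mk⇔ (B⇒C2 ∘ A⇒B ∘ C1⇒A) (B⇒C1 ∘ A⇒B ∘ C2⇒A)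
  where
  A⇒B : CondA b bS m → CondB b bS m
  A⇒B = CondA⇒CondB b bS submodular b⊥≡0 b⊤≡bS m m∈B
  B⇒C1 : CondB b bS m → DecMin b bS m
  B⇒C1 = CondB⇒DecMin b bS m
  B⇒C2 : CondB b bS m → IncMax b bS m
  B⇒C2 = CondB⇒IncMax b bS m b⊤≡bS m∈B
  C1⇒A : DecMin b bS m → CondA b bS m
  C1⇒A = DecMin⇒CondA b bS m
  C2⇒A : IncMax b bS m → CondA b bS m
  C2⇒A = IncMax⇒CondA b bS m
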